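{- Let $G=(V,E)$ be a directed acyclic graph with no active cycle, and let $T: x_0\sim x_1\sim\cdots\sim x_n\sim x_{n+1}$ ($n\ge0$) be a trail in $G$ that has the minimum number of nodes among all trails between $x_0$ and $x_{n+1}$ activated by the empty set. Then (i) $\mathrm{ch}(x_0)\cap\mathrm{ch}(x_{n+1})\subseteq\bigcap_{i=1}^{n}\mathrm{ch}(x_i)$, and (ii) for all $i=1,\dots,n$, $x_i\notin\mathrm{ch}(x_0)\cap\mathrm{ch}(x_{n+1})$.
   Context: Graphs are finite, simple, without loops; $\mathrm{ch}(v)$ denotes the set of children of $v$. A trail is a sequence of pairwise distinct nodes with consecutive nodes adjacent (arc in either direction). An interior node $v_j$ is a converging connection if $v_{j-1}\to v_j\leftarrow v_{j+1}$, otherwise serial or diverging. A trail is activated by the empty set iff it has no converging connection. $G$ contains an active cycle if there exist a node $v$, distinct parents $w,z$ of $v$, and a trail $w\sim y_1\sim\cdots\sim y_m\sim z$ with $m\ge1$ all of whose interior nodes are serial or diverging connections, such that the cycle $v,w,y_1,\dots,y_m,z$ has no arc of $G$ between two of its nodes that are not consecutive in this cyclic order. -}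

module Defs where

open import Data.Nat using (ℕ; zero; suc; _≤_)
open import Data.Fin using (Fin; toℕ)
open import Data.List using (List; []; _∷_; _++_; length; lookup)
open import Data.List.Relation.Unary.All using (All)
open import Data.List.Relation.Unary.Unique.Propositional using (Unique)
open import Data.List.Membership.Propositional using (_∈_; _∉_)
open import Data.Product using (_×_; Σ; ∃; ∃-syntax)
open import Data.Unit using (⊤)
open import Data.Sum using (_⊎_)
open import Data.Empty using (⊥)
open import Relation.Nullary using (¬_; Dec)
open import Relation.Binary.PropositionalEquality using (_≡_; _≢_)
open import Relation.Binary.Construct.Closure.Transitive using (TransClosure)

record Digraph : Set₁ where
  field
    N      : ℕ
    E      : Fin N → Fin N → Set
    E-dec  : ∀ u v → Dec (E u v)
    noLoop : ∀ v → ¬ E v v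

module _ (G : Digraph) where
  open Digraph G

  Node : Set
  Node = Fin N

  Acyclic : Set
  Acyclic = ∀ v → ¬ TransClosure E v v

  Adj : Node → Node → Set
  Adj u v = E u v ⊎ E v u

  Chain : List Node → Set
  Chain []            = ⊤
  Chain (x ∷ [])      = ⊤
  Chain (x ∷ y ∷ r)   = Adj x y × Chain (y ∷ r)

  IsTrail : List Node → Set
  IsTrail t = Unique t × Chain t

  NoConverging : List Node → Set
  NoConverging (x ∷ y ∷ z ∷ r) = ¬ (E x y × E z y) × NoConverging (y ∷ z ∷ r)
  NoConverging _ = ⊤

  -- the trail a ∼ mids ∼ b (node list a ∷ mids ++ [b]) is a trail activated by ∅
  ActiveTrail : Node → List Node → Node → Set
  ActiveTrail a mids b = IsTrail (a ∷ mids ++ b ∷ []) × NoConverging (a ∷ mids ++ b ∷ [])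

  -- positions a, b (of a cycle of length k) are distinct and not cyclically consecutive
  NonConsec : ℕ → ℕ → ℕ → Set
  NonConsec k a b = a ≢ b × suc a ≢ b × suc b ≢ a
                    × ¬ (a ≡ 0 × suc b ≡ k) × ¬ (b ≡ 0 × suc a ≡ k)

  Chordless : List Node → Set
  Chordless c = ∀ (i j : Fin (length c)) → NonConsec (length c) (toℕ i) (toℕ j)
                → ¬ E (lookup c i) (lookup c j)

  HasActiveCycle : Set
  HasActiveCycle =
    ∃[ v ] ∃[ w ] ∃[ z ] ∃[ ys ]
      ( E w v × E z v × w ≢ z × 1 ≤ length ys
      × ActiveTrail w ys z
      × v ∉ (w ∷ ys ++ z ∷ [])
      × Chordless (v ∷ w ∷ ys ++ z ∷ []) )

  MinActiveTrail : Node → List Node → Node → Set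
  MinActiveTrail a mids b =
    ActiveTrail a mids b × (∀ mids' → ActiveTrail a mids' b → length mids ≤ length mids')

{-# OPTIONS --safe #-}
module Submission where

-- In a DAG a trail without converging connections is a trek: each of its nodes is a proper
-- ancestor of all nodes on one of its two sides.  So every node of T is an ancestor of each
-- common child c of x₀ and xₙ₊₁; for c = xᵢ this is a cycle, whence (ii), and in general c is
-- neither on T nor a parent of a node of T.  Minimality makes T chordless, since a chord would
-- shortcut it to a shorter active trail.  Hence if some xᵢ were not a parent of c, a maximal
-- run of such nodes between two parents w, z of c would give an active cycle c, w, …, z.

open import Defs
open import Data.Empty using (⊥-elim)
open import Data.Fin using (Fin; zero; suc; toℕ)
open import Data.List using (List; []; _∷_; _++_; length; lookup)
open import Data.List.Properties using (∷-injectiveˡ; ∷-injectiveʳ)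
open import Data.List.Membership.Propositional using (_∈_)
open import Data.List.Membership.Propositional.Properties using (∈-++⁺ˡ; ∈-++⁺ʳ; ∈-∃++; ∈-lookup)
open import Data.List.Relation.Unary.All as All using (All; []; _∷_)
open import Data.List.Relation.Unary.All.Properties using (++⁺)
open import Data.List.Relation.Unary.AllPairs as AllPairs using (AllPairs; []; _∷_)
open import Data.List.Relation.Unary.Any using (here; there)
open import Data.List.Relation.Unary.Unique.Propositional using (Unique)
open import Data.List.Relation.Unary.Linked as Linked using (Linked; [-]; _∷_)
open import Data.List.Relation.Unary.Linked.Properties using (Linked⇒AllPairs)
open import Data.List.Relation.Binary.Sublist.Propositional
  using (_⊆_; []; _∷_; _∷ʳ_; ⊆-refl; ⊆-trans; from∈; to∈)
import Data.List.Relation.Binary.Sublist.Propositional.Properties as Sublist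
open import Data.Nat using (_+_; _≤_; s≤s; z≤n)
open import Data.Nat.Properties using (+-suc; ≤∧≢⇒<; <-cmp; m+n≮n)
open import Data.Product using (_×_; _,_; proj₁; proj₂; ∃-syntax; map₂)
open import Data.Sum using (_⊎_; inj₁; inj₂; [_,_]′) renaming (map to ⊎-map)
open import Data.Unit using (⊤; tt)
open import Function using (_∘_)
open import Relation.Binary.Definitions using (tri<; tri≈; tri>)
open import Relation.Binary.PropositionalEquality using (_≡_; _≢_; refl; sym; trans; cong; cong₂; subst)
open import Relation.Binary.Construct.Closure.Transitive
  using (TransClosure; [_]; _∷_) renaming (_∷ʳ_ to _∷ʳ⁺_; transitive to ⁺-transitive)
open import Relation.Nullary using (¬_; yes; no)
open import Relation.Unary using (Decidable; ∁)

module _ {A : Set} where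

  AllPairs-resp-⊇ : ∀ {R : A → A → Set} {xs ys} → xs ⊆ ys → AllPairs R ys → AllPairs R xs
  AllPairs-resp-⊇ []         []       = []
  AllPairs-resp-⊇ (_ ∷ʳ σ)   (_ ∷ rs) = AllPairs-resp-⊇ σ rs
  AllPairs-resp-⊇ (refl ∷ σ) (r ∷ rs) = Sublist.All-resp-⊆ σ r ∷ AllPairs-resp-⊇ σ rs

  ⊆-split-around : ∀ {u b v : A} {l} → u ∷ b ∷ v ∷ [] ⊆ l
                 → ∃[ P ] ∃[ x ] ∃[ M ] ∃[ C ] l ≡ P ++ u ∷ (x ∷ M) ++ v ∷ C
  ⊆-split-around (y ∷ʳ σ) with ⊆-split-around σ
  ... | P , x , M , C , eq = y ∷ P , x , M , C , cong (y ∷_) eq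
  ⊆-split-around {l = _ ∷ x ∷ _} (refl ∷ σ) with ∈-∃++ (to∈ (Sublist.∷⁻ σ))
  ... | M , C , eq = [] , x , M , C , cong (λ t → _ ∷ x ∷ t) eq
  ⊆-split-around {l = _ ∷ []} (refl ∷ ())

  ∷ʳ-suffix : ∀ xs Y {b k : A} {K} → xs ++ b ∷ [] ≡ Y ++ k ∷ K
            → ∃[ K′ ] k ∷ K ≡ K′ ++ b ∷ [] × length Y + length K′ ≡ length xs
  ∷ʳ-suffix xs       []          eq = xs , sym eq , refl
  ∷ʳ-suffix (x ∷ xs) (y ∷ Y)     eq = map₂ (map₂ (cong (1 +_))) (∷ʳ-suffix xs Y (∷-injectiveʳ eq))
  ∷ʳ-suffix []       (y ∷ [])    ()
  ∷ʳ-suffix []       (y ∷ _ ∷ _) ()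

  delete-infix : ∀ {a b u v : A} m P M {C} → a ∷ m ++ b ∷ [] ≡ P ++ u ∷ M ++ v ∷ C
               → ∃[ m′ ] P ++ u ∷ v ∷ C ≡ a ∷ m′ ++ b ∷ [] × length M + length m′ ≡ length m
  delete-infix m [] M eq with ∷ʳ-suffix m M (∷-injectiveʳ eq)
  ... | m′ , e , len = m′ , cong₂ _∷_ (sym (∷-injectiveˡ eq)) e , len
  delete-infix (x ∷ m) (p ∷ P) M eq with delete-infix m P M (∷-injectiveʳ eq)
  ... | m′ , e , len = x ∷ m′ , cong₂ _∷_ (sym (∷-injectiveˡ eq)) e , trans (+-suc _ _) (cong (1 +_) len)
  delete-infix [] (p ∷ [])        []      ()
  delete-infix [] (p ∷ [])        (_ ∷ _) ()
  delete-infix [] (p ∷ _ ∷ [])    _       ()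
  delete-infix [] (p ∷ _ ∷ _ ∷ _) _       ()

  lookup-⊆ : ∀ (l : List A) (i j : Fin (length l)) → 2 + toℕ i ≤ toℕ j
           → ∃[ b ] lookup l i ∷ b ∷ lookup l j ∷ [] ⊆ l
  lookup-⊆ (x ∷ y ∷ l) zero    (suc (suc j)) _         = y , refl ∷ refl ∷ from∈ (∈-lookup j)
  lookup-⊆ (x ∷ l)     (suc i) (suc j)       (s≤s i<j) = map₂ (x ∷ʳ_) (lookup-⊆ l i j i<j)
  lookup-⊆ (x ∷ y ∷ l) zero    (suc zero)    (s≤s ())

  lookup-∷ʳ-init : ∀ g (z : A) (k : Fin (length (g ++ z ∷ [])))
                 → 1 + toℕ k ≢ length (g ++ z ∷ []) → lookup (g ++ z ∷ []) k ∈ g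
  lookup-∷ʳ-init []      z zero    last = ⊥-elim (last refl)
  lookup-∷ʳ-init (y ∷ g) z zero    _    = here refl
  lookup-∷ʳ-init (y ∷ g) z (suc k) last = there (lookup-∷ʳ-init g z k (last ∘ cong (1 +_)))

  split-at-first : ∀ {P : A → Set} → Decidable P → ∀ {z} → P z → ∀ ys
                 → ∃[ N ] ∃[ y ] ∃[ R ] ys ++ z ∷ [] ≡ (N ++ y ∷ []) ++ R × All (∁ P) N × P y
  split-at-first P? pz [] = [] , _ , [] , refl , [] , pz
  split-at-first P? {z} pz (y ∷ ys) with P? y
  ... | yes py = [] , y , ys ++ z ∷ [] , refl , [] , py
  ... | no ¬py with split-at-first P? pz ys
  ...   | N , y′ , R , eq , ¬pN , py′ = y ∷ N , y′ , R , cong (y ∷_) eq , ¬py ∷ ¬pN , py′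

module _ (G : Digraph) (acyclic : Acyclic G) where
  open Digraph G

  private
    V : Set
    V = Node G

  _⟶⁺_ : V → V → Set
  _⟶⁺_ = TransClosure E

  Chain-tail : ∀ {x} l → Chain G (x ∷ l) → Chain G l
  Chain-tail []      _        = tt
  Chain-tail (_ ∷ _) (_ , ch) = ch

  Chain-++⁻ˡ : ∀ P R → Chain G (P ++ R) → Chain G P
  Chain-++⁻ˡ []          R _        = tt
  Chain-++⁻ˡ (x ∷ [])    R _        = tt
  Chain-++⁻ˡ (x ∷ y ∷ P) R (a , ch) = a , Chain-++⁻ˡ (y ∷ P) R ch

  Chain-++⁻ʳ : ∀ P R → Chain G (P ++ R) → Chain G R
  Chain-++⁻ʳ []      R ch = ch
  Chain-++⁻ʳ (x ∷ P) R ch = Chain-++⁻ʳ P R (Chain-tail (P ++ R) ch)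

  Chain-shortcut : ∀ P {u} M {v C} → Chain G (P ++ u ∷ M ++ v ∷ C) → Adj G u v
                 → Chain G (P ++ u ∷ v ∷ C)
  Chain-shortcut []          M ch       adj = adj , Chain-++⁻ʳ M _ (Chain-tail (M ++ _) ch)
  Chain-shortcut (x ∷ [])    M (a , ch) adj = a , Chain-shortcut [] M ch adj
  Chain-shortcut (x ∷ y ∷ P) M (a , ch) adj = a , Chain-shortcut (y ∷ P) M ch adj

  NoConverging-tail : ∀ {x} l → NoConverging G (x ∷ l) → NoConverging G l
  NoConverging-tail []          _        = tt
  NoConverging-tail (_ ∷ [])    _        = tt
  NoConverging-tail (_ ∷ _ ∷ _) (_ , nc) = nc

  -- `before` holds the nodes already passed, nearest first.  On a chain in a DAG, Trek [] is
  -- equivalent to NoConverging, and unlike NoConverging it is inherited by sublists.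
  Trek : List V → List V → Set
  Trek before []          = ⊤
  Trek before (y ∷ after) = (All (y ⟶⁺_) before ⊎ All (y ⟶⁺_) after) × Trek (y ∷ before) after

  Trek-resp-⊆ : ∀ {before before′ after after′} → before′ ⊆ before → after′ ⊆ after
              → Trek before after → Trek before′ after′
  Trek-resp-⊆ β []         _          = tt
  Trek-resp-⊆ β (y ∷ʳ α)   (_ , t)    = Trek-resp-⊆ (y ∷ʳ β) α t
  Trek-resp-⊆ β (refl ∷ α) (side , t) =
    ⊎-map (Sublist.All-resp-⊆ β) (Sublist.All-resp-⊆ α) side , Trek-resp-⊆ (refl ∷ β) α t

  AllPairs⇒Trek : ∀ {before after} → AllPairs _⟶⁺_ after → Trek before after
  AllPairs⇒Trek []       = tt
  AllPairs⇒Trek (r ∷ rs) = inj₂ r , AllPairs⇒Trek rs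

  forward-path : ∀ {x y} l → E x y → Chain G (y ∷ l) → NoConverging G (x ∷ y ∷ l)
               → Linked E (x ∷ y ∷ l)
  forward-path []      exy _               _           = exy ∷ [-]
  forward-path (z ∷ l) exy (inj₁ eyz , ch) (_ , nc)    = exy ∷ forward-path l eyz ch nc
  forward-path (z ∷ l) exy (inj₂ ezy , _)  (¬conv , _) = ⊥-elim (¬conv (exy , ezy))

  active⇒Trek′ : ∀ {before y} after → All (y ⟶⁺_) before → Chain G (y ∷ after)
               → NoConverging G (y ∷ after) → Trek before (y ∷ after)
  active⇒Trek′ []      up _               _  = inj₁ up , tt
  active⇒Trek′ (z ∷ l) up (inj₂ ezy , ch) nc =
    inj₁ up , active⇒Trek′ l ([ ezy ] ∷ All.map (ezy ∷_) up) ch (NoConverging-tail (z ∷ l) nc)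
  active⇒Trek′ (z ∷ l) up (inj₁ eyz , ch) nc =
    AllPairs⇒Trek (Linked⇒AllPairs (⁺-transitive E) (Linked.map [_] (forward-path l eyz ch nc)))

  active⇒Trek : ∀ l → Chain G l → NoConverging G l → Trek [] l
  active⇒Trek []      _  _  = tt
  active⇒Trek (y ∷ l) ch nc = active⇒Trek′ l [] ch nc

  Trek⇒NoConverging : ∀ {before} l → Trek before l → NoConverging G l
  Trek⇒NoConverging (x ∷ y ∷ z ∷ r) (_ , t@(side , _)) =
    no-collider side , Trek⇒NoConverging (y ∷ z ∷ r) t
    where
    no-collider : All (y ⟶⁺_) (x ∷ _) ⊎ All (y ⟶⁺_) (z ∷ r) → ¬ (E x y × E z y)
    no-collider (inj₁ (y⟶⁺x ∷ _)) (exy , _) = acyclic y (y⟶⁺x ∷ʳ⁺ exy)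
    no-collider (inj₂ (y⟶⁺z ∷ _)) (_ , ezy) = acyclic y (y⟶⁺z ∷ʳ⁺ ezy)
  Trek⇒NoConverging []           _ = tt
  Trek⇒NoConverging (_ ∷ [])     _ = tt
  Trek⇒NoConverging (_ ∷ _ ∷ []) _ = tt

  ActiveList : List V → Set
  ActiveList l = IsTrail G l × NoConverging G l

  ActiveList-shortcut : ∀ P {u} M {v C} → ActiveList (P ++ u ∷ M ++ v ∷ C) → Adj G u v
                      → ActiveList (P ++ u ∷ v ∷ C)
  ActiveList-shortcut P M ((unique , ch) , nc) adj =
    (AllPairs-resp-⊇ σ unique , Chain-shortcut P M ch adj) ,
    Trek⇒NoConverging _ (Trek-resp-⊆ [] σ (active⇒Trek _ ch nc))
    where
    σ = Sublist.++⁺ ⊆-refl (refl ∷ Sublist.++⁺ˡ M ⊆-refl)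

  Trek-interior : ∀ {a m b y} → Trek [] (a ∷ m ++ b ∷ []) → y ∈ m → y ⟶⁺ a ⊎ y ⟶⁺ b
  Trek-interior t y∈m with Trek-resp-⊆ [] (refl ∷ Sublist.++⁺ (from∈ y∈m) ⊆-refl) t
  ... | _ , side , _ = ⊎-map All.head All.head side

  Trek-⟶⁺commonChild : ∀ {a m b c} → Trek [] (a ∷ m ++ b ∷ []) → E a c → E b c
                     → All (_⟶⁺ c) (a ∷ m ++ b ∷ [])
  Trek-⟶⁺commonChild t eac ebc =
    [ eac ] ∷ ++⁺ (All.tabulate (λ y∈m → [ _∷ʳ⁺ eac , _∷ʳ⁺ ebc ]′ (Trek-interior t y∈m)))
                  ([ ebc ] ∷ [])

  ActiveTrail-interior-not-commonChild : ∀ {a m b y} → ActiveTrail G a m b → y ∈ m → ¬ (E a y × E b y)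
  ActiveTrail-interior-not-commonChild ((_ , ch) , nc) y∈m (eay , eby) =
    acyclic _ (All.lookup (Trek-⟶⁺commonChild (active⇒Trek _ ch nc) eay eby) (there (∈-++⁺ˡ y∈m)))

  -- u ∷ b ∷ v ∷ [] ⊆ l says that v occurs after u on l, but not right after it
  Induced : List V → Set
  Induced l = ∀ {u b v} → u ∷ b ∷ v ∷ [] ⊆ l → ¬ Adj G u v

  MinActiveTrail⇒Induced : ∀ {a m b} → MinActiveTrail G a m b → Induced (a ∷ m ++ b ∷ [])
  MinActiveTrail⇒Induced {a} {m} {b} (active , minimal) σ adj with ⊆-split-around σ
  ... | P , x , M , C , eq with delete-infix m P (x ∷ M) eq
  ... | m′ , eq′ , len =
    m+n≮n (length M) (length m′) (subst (_≤ length m′) (sym len) (minimal m′ shorter))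
    where
    shorter : ActiveTrail G a m′ b
    shorter = subst ActiveList eq′ (ActiveList-shortcut P (x ∷ M) (subst ActiveList eq active) adj)

  Induced-lookup : ∀ {l} → Induced l → ∀ i j → 2 + toℕ i ≤ toℕ j → ¬ Adj G (lookup l i) (lookup l j)
  Induced-lookup {l} induced i j i+2≤j = induced (proj₂ (lookup-⊆ l i j i+2≤j))

  Induced⇒Chordless : ∀ {c w g z} → Induced (w ∷ g ++ z ∷ [])
                    → (∀ {y} → y ∈ w ∷ g ++ z ∷ [] → ¬ E c y) → All (λ y → ¬ E y c) g
                    → Chordless G (c ∷ w ∷ g ++ z ∷ [])
  Induced⇒Chordless _ _ _ zero zero (i≢j , _) = ⊥-elim (i≢j refl)
  Induced⇒Chordless _ ¬c⟶ _ zero (suc j) _ = ¬c⟶ (∈-lookup j)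
  Induced⇒Chordless _ _ _ (suc zero) zero (_ , _ , j+1≢i , _) = ⊥-elim (j+1≢i refl)
  Induced⇒Chordless {g = g} {z} _ _ ¬⟶c (suc (suc i)) zero (_ , _ , _ , _ , ¬last) =
    All.lookup ¬⟶c (lookup-∷ʳ-init g z i (λ eq → ¬last (refl , cong (2 +_) eq)))
  Induced⇒Chordless induced _ _ (suc i) (suc j) (i≢j , i+1≢j , j+1≢i , _)
    with <-cmp (toℕ i) (toℕ j)
  ... | tri< i<j _ _ = Induced-lookup induced i j (≤∧≢⇒< i<j (i+1≢j ∘ cong (1 +_))) ∘ inj₁
  ... | tri≈ _ i≡j _ = ⊥-elim (i≢j (cong (1 +_) i≡j))
  ... | tri> _ _ j<i = Induced-lookup induced j i (≤∧≢⇒< j<i (j+1≢i ∘ cong (1 +_))) ∘ inj₂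

  module MinimalTrail {a m b} (minimal : MinActiveTrail G a m b) where

    private
      L : List V
      L = a ∷ m ++ b ∷ []

      uniqueL : Unique L
      uniqueL = proj₁ (proj₁ (proj₁ minimal))

      chainL : Chain G L
      chainL = proj₂ (proj₁ (proj₁ minimal))

      trek : Trek [] L
      trek = active⇒Trek L chainL (proj₂ (proj₁ minimal))

    Subtrail : List V → Set
    Subtrail s = s ⊆ L × Chain G s

    Subtrail-++⁻ˡ : ∀ P R → Subtrail (P ++ R) → Subtrail P
    Subtrail-++⁻ˡ P R (σ , ch) = ⊆-trans (Sublist.++⁺ʳ R ⊆-refl) σ , Chain-++⁻ˡ P R ch

    module _ {c} (eac : E a c) (ebc : E b c) where

      gap⇒ActiveCycle : ∀ {w g z} → Subtrail (w ∷ g ++ z ∷ []) → 1 ≤ length g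
                      → All (λ y → ¬ E y c) g → E w c → E z c → HasActiveCycle G
      gap⇒ActiveCycle {w} {g} {z} (σ , ch) 1≤|g| ¬⟶c ewc ezc =
        c , w , z , g , ewc , ezc , w≢z , 1≤|g| ,
        ((unique , ch) , Trek⇒NoConverging _ (Trek-resp-⊆ [] σ trek)) , c∉ ,
        Induced⇒Chordless induced ¬c⟶ ¬⟶c
        where
        unique : Unique (w ∷ g ++ z ∷ [])
        unique = AllPairs-resp-⊇ σ uniqueL
        w≢z : w ≢ z
        w≢z = All.lookup (AllPairs.head unique) (∈-++⁺ʳ g (here refl))
        ⟶⁺c : All (_⟶⁺ c) (w ∷ g ++ z ∷ [])
        ⟶⁺c = Sublist.All-resp-⊆ σ (Trek-⟶⁺commonChild trek eac ebc)
        c∉ : ¬ c ∈ w ∷ g ++ z ∷ []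
        c∉ c∈ = acyclic c (All.lookup ⟶⁺c c∈)
        ¬c⟶ : ∀ {y} → y ∈ w ∷ g ++ z ∷ [] → ¬ E c y
        ¬c⟶ y∈ ecy = acyclic c (ecy ∷ All.lookup ⟶⁺c y∈)
        induced : Induced (w ∷ g ++ z ∷ [])
        induced τ = MinActiveTrail⇒Induced minimal (⊆-trans τ σ)

      parents-between : ¬ HasActiveCycle G → ∀ {w} ys {z} → Subtrail (w ∷ ys ++ z ∷ [])
                      → E w c → E z c → All (λ y → E y c) ys
      parents-between _ [] _ _ _ = []
      parents-between noActiveCycle {w} (y ∷ ys) s@(σ , _ , ch) ewc ezc with E-dec y c
      ... | yes eyc = eyc ∷ parents-between noActiveCycle ys (Sublist.∷ˡ⁻ σ , ch) eyc ezc
      ... | no ¬eyc with split-at-first (λ x → E-dec x c) ezc ys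
      ...   | N , y′ , R , eq , ¬⟶c , ey′c =
        ⊥-elim (noActiveCycle (gap⇒ActiveCycle gap (s≤s z≤n) (¬eyc ∷ ¬⟶c) ewc ey′c))
        where
        gap : Subtrail (w ∷ (y ∷ N) ++ y′ ∷ [])
        gap = Subtrail-++⁻ˡ (w ∷ y ∷ N ++ y′ ∷ []) R (subst (λ t → Subtrail (w ∷ y ∷ t)) eq s)

      parents-of-commonChild : ¬ HasActiveCycle G → All (λ y → E y c) m
      parents-of-commonChild noActiveCycle =
        parents-between noActiveCycle m (⊆-refl , chainL) eac ebc

lemma4p8 : (G : Digraph) → Acyclic G → ¬ HasActiveCycle G
    → (x₀ : Node G) (xs : List (Node G)) (xₙ₊₁ : Node G)
    → MinActiveTrail G x₀ xs xₙ₊₁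
    → (∀ c → Digraph.E G x₀ c → Digraph.E G xₙ₊₁ c → All (λ xᵢ → Digraph.E G xᵢ c) xs)
    × (∀ xᵢ → xᵢ ∈ xs → ¬ (Digraph.E G x₀ xᵢ × Digraph.E G xₙ₊₁ xᵢ))
lemma4p8 G acyclic noActiveCycle x₀ xs xₙ₊₁ minimal =
  (λ c e₀ eₙ → parents-of-commonChild e₀ eₙ noActiveCycle) ,
  (λ xᵢ → ActiveTrail-interior-not-commonChild G acyclic (proj₁ minimal))
  where open MinimalTrail G acyclic minimal
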